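{- Let $\sigma=\sigma_1\cdots\sigma_m$ and $\pi=\pi_1\cdots\pi_n$ be signed permutations of disjoint sets $A,B$ of positive integers, with $\sigma_m\prec\pi_n$. Then $$\sum_{\alpha\in\mathfrak{S}^{sb}(\sigma,\pi)}q^{\mathrm{fmaj}(\alpha)}=q^{\mathrm{fmaj}(\sigma)+\mathrm{fmaj}(\pi)+2n}{n+m-1\brack n}_{q^2}.$$
   Context: A signed permutation of a finite set $A$ of positive integers is a word $w_1\cdots w_m$ with $|w_1|\cdots|w_m|$ a permutation of $A$. The order $\prec$ on nonzero integers is: $-a\prec-b$ iff $a<b$; every negative integer precedes every positive one; positive integers in usual order (i.e. $-1\prec-2\prec\cdots\prec1\prec2\prec\cdots$). For a signed word $w$, $\mathrm{fmaj}(w)=2\sum\{i:w_{i+1}\prec w_i\}+\#\{i:w_i<0\}$. A shuffle of $\sigma$ and $\pi$ is a word of length $m+n$ containing both $\sigma$ and $\pi$ as subsequences; $\mathfrak{S}^{sb}(\sigma,\pi)$ is the set of shuffles $\alpha$ whose last letter $\alpha_{n+m}$ is the $\prec$-minimum of $\{\sigma_m,\pi_n\}$, i.e. $\alpha_{n+m}=\sigma_m$. ${N\brack n}_q=\frac{[N]_q!}{[n]_q![N-n]_q!}$, $[j]_q=1+\cdots+q^{j-1}$. -}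

module Defs where

open import Data.Nat using (ℕ; zero; suc; _+_; _*_; _^_; _<ᵇ_)
open import Data.Integer using (ℤ; +_; -[1+_]; ∣_∣)
open import Data.Bool using (Bool; true; false; if_then_else_)
open import Data.List using (List; []; _∷_; map; length; filter)
open import Data.Nat.ListAction using (sum)
open import Data.List.Relation.Unary.All using (All)
open import Data.List.Relation.Unary.Unique.Propositional using (Unique)
open import Data.List.Membership.Propositional using (_∈_; _∉_)
open import Data.Integer.Properties using () renaming (_≟_ to _≟ℤ_)
open import Relation.Nullary using (¬_; Dec; yes; no)
open import Relation.Binary.PropositionalEquality using (_≡_)

SignedWord : Set
SignedWord = List ℤ

-- The total order ≺ on nonzero integers:
--   -1 ≺ -2 ≺ ⋯ ≺ 1 ≺ 2 ≺ ⋯   (as a Boolean test)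
_≺ᵇ_ : ℤ → ℤ → Bool
-[1+ a ] ≺ᵇ -[1+ b ] = a <ᵇ b
-[1+ a ] ≺ᵇ (+ b)    = true
(+ a)    ≺ᵇ -[1+ b ] = false
(+ a)    ≺ᵇ (+ b)    = a <ᵇ b

_≺_ : ℤ → ℤ → Set
x ≺ y = (x ≺ᵇ y) ≡ true

isNeg : ℤ → Bool
isNeg -[1+ _ ] = true
isNeg (+ _)    = false

-- Σ { i : w_{i+1} ≺ w_i }, positions counted from i (the position of the head)
descSumFrom : ℕ → SignedWord → ℕ
descSumFrom i []           = 0
descSumFrom i (x ∷ [])     = 0
descSumFrom i (x ∷ y ∷ w)  =
  (if y ≺ᵇ x then i else 0) + descSumFrom (suc i) (y ∷ w)

negCount : SignedWord → ℕ
negCount []      = 0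
negCount (x ∷ w) = (if isNeg x then 1 else 0) + negCount w

fmaj : SignedWord → ℕ
fmaj w = 2 * descSumFrom 1 w + negCount w

IsSignedPerm : SignedWord → Set
IsSignedPerm w = All (λ x → ¬ (x ≡ + 0)) w × Unique (map ∣_∣ w)
  where open import Data.Product using (_×_)

DisjointSupp : SignedWord → SignedWord → Set
DisjointSupp s p = ∀ {a} → a ∈ map ∣_∣ s → a ∉ map ∣_∣ p

shuffles : SignedWord → SignedWord → List SignedWord
shuffles []      v       = v ∷ []
shuffles (x ∷ u) []      = (x ∷ u) ∷ []
shuffles (x ∷ u) (y ∷ v) =
  map (x ∷_) (shuffles u (y ∷ v)) Data.List.++ map (y ∷_) (shuffles (x ∷ u) v)

endsWith : ℤ → SignedWord → Bool
endsWith c []          = false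
endsWith c (x ∷ [])    = Relation.Nullary.Decidable.⌊ x ≟ℤ c ⌋
  where import Relation.Nullary.Decidable
endsWith c (x ∷ y ∷ w) = endsWith c (y ∷ w)

-- 𝔖^{sb}(σ,π): shuffles whose last letter is σ_m (= c)
shufflesSb : ℤ → SignedWord → SignedWord → List SignedWord
shufflesSb c s p = filter (λ α → Data.Bool.T? (endsWith c α)) (shuffles s p)
  where import Data.Bool

fmajGen : ℕ → List SignedWord → ℕ
fmajGen q L = sum (map (λ α → q ^ fmaj α) L)

qInt : ℕ → ℕ → ℕ
qInt q zero    = 0
qInt q (suc j) = 1 + q * qInt q j

qFact : ℕ → ℕ → ℕ
qFact q zero    = 1
qFact q (suc j) = qInt q (suc j) * qFact q j

-- Write σ = u ∷ʳ a and π = v ∷ʳ b, with no letter shared by σ and π. Whichever of a and b is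
-- ≺-smaller, the shuffles ending in a satisfy
--   Σ q^fmaj = q^(fmaj σ + fmaj π + 2|π|[a ≺ b]) [|σ| + |π| - 1 choose |σ| - 1]_{q²}   (fmajClosed),
-- and the theorem is the case a ≺ b. Deleting the final a from such a shuffle leaves a shuffle of
-- u ∷ʳ z (z the last letter of u) and π ending in z or in b, and appending a to a word of length ℓ
-- ending in c multiplies q^fmaj by q^(2ℓ[a ≺ c] + [a < 0]). So the sum obeys a recursion whose
-- second branch is the same statement with σ and π exchanged. The closed form obeys it too: after
-- factoring out a common power, the two branches are the two terms of one of the two q-Pascal
-- rules, which one being dictated by the relative order of a, z and b (descent-cocycle).

module Submission where

open import Defs
open import Algebra.Bundles using (CommutativeMonoid)
import Algebra.Properties.CommutativeSemigroup as CommutativeSemigroupProperties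
open import Data.Bool using (Bool; true; false; not; if_then_else_; T; T?)
open import Data.Bool.Properties using (T-≡)
open import Data.Integer as ℤ using (ℤ; -[1+_]; ∣_∣)
open import Data.Integer.Properties using () renaming (_≟_ to _≟ℤ_)
open import Data.List using (List; []; _∷_; [_]; _++_; _∷ʳ_; length; map; filter)
open import Data.List.Properties
  using (map-++; map-∘; length-++; ++-identityʳ; filter-++; filter-all; filter-none)
open import Data.List.Reverse using (Reverse; []; _∶_∶ʳ_; reverseView)
open import Data.List.Membership.Propositional.Properties using (∈-++⁺ˡ; ∈-++⁺ʳ; ∈-map⁺)
open import Data.List.Relation.Unary.All using (All; []; _∷_)
import Data.List.Relation.Unary.All as All
import Data.List.Relation.Unary.All.Properties as All
open import Data.List.Relation.Unary.Any using (here)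
open import Data.List.Relation.Binary.Disjoint.Propositional using (Disjoint)
import Data.List.Relation.Binary.Disjoint.Propositional.Properties as Disjoint
open import Data.List.Relation.Binary.Permutation.Propositional
  using (_↭_; ↭-refl; ↭-trans; ↭-prep; ↭-swap; module PermutationReasoning)
import Data.List.Relation.Binary.Permutation.Propositional.Properties as ↭
open import Data.Nat using (ℕ; zero; suc; _+_; _*_; _^_; _<ᵇ_; _<_; NonZero)
open import Data.Nat.Properties
open import Data.Nat.ListAction using (sum)
open import Data.Nat.ListAction.Properties using (sum-++; sum-↭)
open import Data.Nat.Tactic.RingSolver using (solve-∀)
open import Data.Product using (_×_; _,_; ∃-syntax)
open import Data.Sum using (_⊎_; inj₁; inj₂)
open import Function.Bundles using (Equivalence)
open import Relation.Binary.Definitions using (tri<; tri≈; tri>)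
open import Relation.Binary.PropositionalEquality hiding ([_])
open import Relation.Nullary using (¬_; contradiction)
open import Relation.Nullary.Decidable using (⌊_⌋; fromWitness; toWitness)

𝟙 : Bool → ℕ
𝟙 b = if b then 1 else 0

<ᵇ≡true⇒< : ∀ m n → (m <ᵇ n) ≡ true → m < n
<ᵇ≡true⇒< m n p = <ᵇ⇒< m n (Equivalence.from T-≡ p)

<⇒<ᵇ≡true : ∀ {m n} → m < n → (m <ᵇ n) ≡ true
<⇒<ᵇ≡true m<n = Equivalence.to T-≡ (<⇒<ᵇ m<n)

≺-irrefl : ∀ x → ¬ x ≺ x
≺-irrefl -[1+ a ] p = <-irrefl refl (<ᵇ≡true⇒< a a p)
≺-irrefl (ℤ.+ a)  p = <-irrefl refl (<ᵇ≡true⇒< a a p)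

≺-trans : ∀ {x y z} → x ≺ y → y ≺ z → x ≺ z
≺-trans { -[1+ a ]} { -[1+ b ]} { -[1+ c ]} p q = <⇒<ᵇ≡true (<-trans (<ᵇ≡true⇒< a b p) (<ᵇ≡true⇒< b c q))
≺-trans { -[1+ _ ]} {_}         {ℤ.+ _}     p q  = refl
≺-trans { -[1+ _ ]} {ℤ.+ _}     { -[1+ _ ]} p ()
≺-trans {ℤ.+ _}     { -[1+ _ ]} {_}         () q
≺-trans {ℤ.+ _}     {ℤ.+ _}     { -[1+ _ ]} p ()
≺-trans {ℤ.+ a}     {ℤ.+ b}     {ℤ.+ c}     p q  = <⇒<ᵇ≡true (<-trans (<ᵇ≡true⇒< a b p) (<ᵇ≡true⇒< b c q))

≺-asym : ∀ {x y} → x ≺ y → (y ≺ᵇ x) ≡ false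
≺-asym {x} {y} x≺y with y ≺ᵇ x in y≺x
... | true  = contradiction (≺-trans {x} {y} {x} x≺y y≺x) (≺-irrefl x)
... | false = refl

≺-total : ∀ {x y} → x ≢ y → x ≺ y ⊎ y ≺ x
≺-total { -[1+ a ]} { -[1+ b ]} x≢y with <-cmp a b
... | tri< a<b _ _ = inj₁ (<⇒<ᵇ≡true a<b)
... | tri≈ _ a≡b _ = contradiction (cong -[1+_] a≡b) x≢y
... | tri> _ _ b<a = inj₂ (<⇒<ᵇ≡true b<a)
≺-total { -[1+ _ ]} {ℤ.+ _}     _   = inj₁ refl
≺-total {ℤ.+ _}     { -[1+ _ ]} _   = inj₂ refl
≺-total {ℤ.+ a}     {ℤ.+ b}     x≢y with <-cmp a b
... | tri< a<b _ _ = inj₁ (<⇒<ᵇ≡true a<b)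
... | tri≈ _ a≡b _ = contradiction (cong ℤ.+_ a≡b) x≢y
... | tri> _ _ b<a = inj₂ (<⇒<ᵇ≡true b<a)

descent-cocycle : ∀ a z b → z ≢ b → ∃[ t ]
    𝟙 (z ≺ᵇ b) + 𝟙 (a ≺ᵇ z) ≡ 𝟙 (a ≺ᵇ b) + 𝟙 (not t)
  × 𝟙 (b ≺ᵇ z) + 𝟙 (a ≺ᵇ b) ≡ 𝟙 (a ≺ᵇ z) + 𝟙 t
descent-cocycle a z b z≢b with ≺-total z≢b
... | inj₁ z≺b rewrite z≺b | ≺-asym {z} {b} z≺b with a ≺ᵇ z in a≺z
...   | true rewrite ≺-trans {a} {z} {b} a≺z z≺b = false , refl , refl
...   | false with a ≺ᵇ b
...     | true  = true , refl , refl
...     | false = false , refl , refl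
descent-cocycle a z b z≢b | inj₂ b≺z rewrite b≺z | ≺-asym {b} {z} b≺z with a ≺ᵇ b in a≺b
...   | true rewrite ≺-trans {a} {b} {z} a≺b b≺z = true , refl , refl
...   | false with a ≺ᵇ z
...     | true  = false , refl , refl
...     | false = true , refl , refl

if≡𝟙* : ∀ b i → (if b then i else 0) ≡ 𝟙 b * i
if≡𝟙* true  i = sym (+-identityʳ i)
if≡𝟙* false i = refl

descent-reindex : ∀ c D k i l → c + (D + k * (suc i + l)) ≡ c + D + k * (i + suc l)
descent-reindex = solve-∀

descSumFrom-∷ʳ : ∀ i w z a →
  descSumFrom i (w ∷ʳ z ∷ʳ a) ≡ descSumFrom i (w ∷ʳ z) + 𝟙 (a ≺ᵇ z) * (i + length w)
descSumFrom-∷ʳ i []          z a =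
  trans (+-identityʳ _) (trans (if≡𝟙* (a ≺ᵇ z) i) (cong (𝟙 (a ≺ᵇ z) *_) (sym (+-identityʳ i))))
descSumFrom-∷ʳ i (x ∷ [])    z a =
  trans (cong (c +_) (descSumFrom-∷ʳ (suc i) [] z a))
        (descent-reindex c (descSumFrom (suc i) [ z ]) (𝟙 (a ≺ᵇ z)) i 0)
  where c = if z ≺ᵇ x then i else 0
descSumFrom-∷ʳ i (x ∷ y ∷ w) z a =
  trans (cong (c +_) (descSumFrom-∷ʳ (suc i) (y ∷ w) z a))
        (descent-reindex c (descSumFrom (suc i) (y ∷ w ∷ʳ z)) (𝟙 (a ≺ᵇ z)) i (length (y ∷ w)))
  where c = if y ≺ᵇ x then i else 0

negCount-∷ʳ : ∀ w a → negCount (w ∷ʳ a) ≡ negCount w + 𝟙 (isNeg a)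
negCount-∷ʳ []      a = +-comm _ 0
negCount-∷ʳ (x ∷ w) a = trans (cong (𝟙 (isNeg x) +_) (negCount-∷ʳ w a)) (sym (+-assoc (𝟙 (isNeg x)) _ _))

fmaj-∷ʳ : ∀ w z a →
  fmaj (w ∷ʳ z ∷ʳ a) ≡ fmaj (w ∷ʳ z) + 2 * (𝟙 (a ≺ᵇ z) * suc (length w)) + 𝟙 (isNeg a)
fmaj-∷ʳ w z a rewrite descSumFrom-∷ʳ 1 w z a | negCount-∷ʳ (w ∷ʳ z) a =
  regroup (descSumFrom 1 (w ∷ʳ z)) (𝟙 (a ≺ᵇ z) * suc (length w)) (negCount (w ∷ʳ z)) (𝟙 (isNeg a))
  where
  regroup : ∀ D k N n → 2 * (D + k) + (N + n) ≡ 2 * D + N + 2 * k + n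
  regroup = solve-∀

snocFactor : ℕ → ℕ → ℤ → ℤ → ℕ
snocFactor q ℓ z a = q ^ (2 * (𝟙 (a ≺ᵇ z) * ℓ) + 𝟙 (isNeg a))

^fmaj-∷ʳ : ∀ q w z a → q ^ fmaj (w ∷ʳ z ∷ʳ a) ≡ q ^ fmaj (w ∷ʳ z) * snocFactor q (suc (length w)) z a
^fmaj-∷ʳ q w z a =
  trans (cong (q ^_) (trans (fmaj-∷ʳ w z a) (+-assoc (fmaj (w ∷ʳ z)) k (𝟙 (isNeg a)))))
        (^-distribˡ-+-* q (fmaj (w ∷ʳ z)) (k + 𝟙 (isNeg a)))
  where k = 2 * (𝟙 (a ≺ᵇ z) * suc (length w))

shuffles-[]ʳ : ∀ u → shuffles u [] ≡ [ u ]
shuffles-[]ʳ []      = refl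
shuffles-[]ʳ (x ∷ u) = refl

shuffles-comm : ∀ u v → shuffles u v ↭ shuffles v u
shuffles-comm []      v       rewrite shuffles-[]ʳ v = ↭-refl
shuffles-comm (x ∷ u) []      = ↭-refl
shuffles-comm (x ∷ u) (y ∷ v) = ↭-trans
  (↭.++⁺ (↭.map⁺ (x ∷_) (shuffles-comm u (y ∷ v))) (↭.map⁺ (y ∷_) (shuffles-comm (x ∷ u) v)))
  (↭.++-comm (map (x ∷_) (shuffles (y ∷ v) u)) _)

shufflesEndingWith : SignedWord → ℤ → SignedWord → ℤ → List SignedWord
shufflesEndingWith u a v b = map (_∷ʳ a) (shuffles u (v ∷ʳ b))

map-∷-∷ʳ : ∀ {A : Set} (x a : A) (ws : List (List A)) →
  map (x ∷_) (map (_∷ʳ a) ws) ≡ map (_∷ʳ a) (map (x ∷_) ws)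
map-∷-∷ʳ x a ws = trans (sym (map-∘ ws)) (map-∘ ws)

shuffles-[]-∷ʳ : ∀ a v b →
  shuffles [ a ] (v ∷ʳ b) ↭ shufflesEndingWith [] a v b ++ shufflesEndingWith v b [] a
shuffles-[]-∷ʳ a []      b = ↭-swap _ _ ↭-refl
shuffles-[]-∷ʳ a (y ∷ v) b = begin
  (a ∷ y ∷ v ∷ʳ b) ∷ map (y ∷_) (shuffles [ a ] (v ∷ʳ b))
    ↭⟨ ↭-prep _ (↭.map⁺ (y ∷_) (shuffles-[]-∷ʳ a v b)) ⟩
  (a ∷ y ∷ v ∷ʳ b) ∷ (y ∷ v ∷ʳ b ∷ʳ a) ∷ map (y ∷_) (map (_∷ʳ b) (shuffles v [ a ]))
    ↭⟨ ↭-trans (↭-swap _ _ ↭-refl) (↭-prep _ (↭.++-comm [ a ∷ y ∷ v ∷ʳ b ] _)) ⟩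
  (y ∷ v ∷ʳ b ∷ʳ a) ∷ map (y ∷_) (map (_∷ʳ b) (shuffles v [ a ])) ++ [ a ∷ y ∷ v ∷ʳ b ]
    ≡⟨ cong (λ ws → (y ∷ v ∷ʳ b ∷ʳ a) ∷ ws ++ [ a ∷ y ∷ v ∷ʳ b ])
            (map-∷-∷ʳ y b (shuffles v [ a ])) ⟩
  (y ∷ v ∷ʳ b ∷ʳ a) ∷ map (_∷ʳ b) (map (y ∷_) (shuffles v [ a ])) ++ map (_∷ʳ b) [ a ∷ y ∷ v ]
    ≡⟨ cong ((y ∷ v ∷ʳ b ∷ʳ a) ∷_) (map-++ (_∷ʳ b) (map (y ∷_) (shuffles v [ a ])) _) ⟨
  shufflesEndingWith [] a (y ∷ v) b ++ shufflesEndingWith (y ∷ v) b [] a ∎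
  where open PermutationReasoning

↭-interchange : ∀ {A : Set} (ws xs ys zs : List A) → (ws ++ xs) ++ (ys ++ zs) ↭ (ws ++ ys) ++ (xs ++ zs)
↭-interchange = CommutativeSemigroupProperties.interchange
  (CommutativeMonoid.commutativeSemigroup ↭.++-commutativeMonoid)

shuffles-∷ʳ : ∀ u a v b →
  shuffles (u ∷ʳ a) (v ∷ʳ b) ↭ shufflesEndingWith u a v b ++ shufflesEndingWith v b u a
shuffles-∷ʳ []      a v       b = shuffles-[]-∷ʳ a v b
shuffles-∷ʳ (x ∷ u) a []      b = begin
  shuffles (x ∷ u ∷ʳ a) [ b ]                   ↭⟨ shuffles-comm (x ∷ u ∷ʳ a) [ b ] ⟩
  shuffles [ b ] (x ∷ u ∷ʳ a)                   ↭⟨ shuffles-[]-∷ʳ b (x ∷ u) a ⟩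
  shufflesEndingWith [] b (x ∷ u) a ++ shufflesEndingWith (x ∷ u) a [] b
    ↭⟨ ↭.++-comm (shufflesEndingWith [] b (x ∷ u) a) _ ⟩
  shufflesEndingWith (x ∷ u) a [] b ++ shufflesEndingWith [] b (x ∷ u) a ∎
  where open PermutationReasoning
shuffles-∷ʳ (x ∷ u) a (y ∷ v) b = begin
  map (x ∷_) (shuffles (u ∷ʳ a) (y ∷ v ∷ʳ b)) ++ map (y ∷_) (shuffles (x ∷ u ∷ʳ a) (v ∷ʳ b))
    ↭⟨ ↭.++⁺ (↭.map⁺ (x ∷_) (shuffles-∷ʳ u a (y ∷ v) b))
             (↭.map⁺ (y ∷_) (shuffles-∷ʳ (x ∷ u) a v b)) ⟩
  map (x ∷_) (Eᵃ ++ Fᵇ) ++ map (y ∷_) (Gᵃ ++ Hᵇ)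
    ≡⟨ cong₂ _++_ (map-++ (x ∷_) Eᵃ Fᵇ) (map-++ (y ∷_) Gᵃ Hᵇ) ⟩
  (map (x ∷_) Eᵃ ++ map (x ∷_) Fᵇ) ++ (map (y ∷_) Gᵃ ++ map (y ∷_) Hᵇ)
    ↭⟨ ↭-interchange (map (x ∷_) Eᵃ) (map (x ∷_) Fᵇ) (map (y ∷_) Gᵃ) (map (y ∷_) Hᵇ) ⟩
  (map (x ∷_) Eᵃ ++ map (y ∷_) Gᵃ) ++ (map (x ∷_) Fᵇ ++ map (y ∷_) Hᵇ)
    ↭⟨ ↭.++⁺ˡ (map (x ∷_) Eᵃ ++ map (y ∷_) Gᵃ)
              (↭.++-comm (map (x ∷_) Fᵇ) (map (y ∷_) Hᵇ)) ⟩
  (map (x ∷_) Eᵃ ++ map (y ∷_) Gᵃ) ++ (map (y ∷_) Hᵇ ++ map (x ∷_) Fᵇ)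
    ≡⟨ cong₂ _++_ (prefix-∷ʳ x y a (shuffles u (y ∷ v ∷ʳ b)) (shuffles (x ∷ u) (v ∷ʳ b)))
                  (prefix-∷ʳ y x b (shuffles v (x ∷ u ∷ʳ a)) (shuffles (y ∷ v) (u ∷ʳ a))) ⟩
  shufflesEndingWith (x ∷ u) a (y ∷ v) b ++ shufflesEndingWith (y ∷ v) b (x ∷ u) a ∎
  where
  open PermutationReasoning
  Eᵃ = shufflesEndingWith u a (y ∷ v) b
  Fᵇ = shufflesEndingWith (y ∷ v) b u a
  Gᵃ = shufflesEndingWith (x ∷ u) a v b
  Hᵇ = shufflesEndingWith v b (x ∷ u) a
  prefix-∷ʳ : ∀ x y c (ws zs : List SignedWord) →
    map (x ∷_) (map (_∷ʳ c) ws) ++ map (y ∷_) (map (_∷ʳ c) zs)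
      ≡ map (_∷ʳ c) (map (x ∷_) ws ++ map (y ∷_) zs)
  prefix-∷ʳ x y c ws zs = trans (cong₂ _++_ (map-∷-∷ʳ x c ws) (map-∷-∷ʳ y c zs))
                                (sym (map-++ (_∷ʳ c) (map (x ∷_) ws) (map (y ∷_) zs)))

length-∷ʳ : ∀ {A : Set} (w : List A) x → length (w ∷ʳ x) ≡ suc (length w)
length-∷ʳ w x = trans (length-++ w) (+-comm (length w) 1)

shuffles-length : ∀ u v → All (λ w → length w ≡ length u + length v) (shuffles u v)
shuffles-length []      v       = refl ∷ []
shuffles-length (x ∷ u) []      = sym (+-identityʳ _) ∷ []
shuffles-length (x ∷ u) (y ∷ v) = All.++⁺
  (All.map⁺ (All.map (cong suc) (shuffles-length u (y ∷ v))))
  (All.map⁺ (All.map (λ eq → cong suc (trans eq (sym (+-suc (length u) (length v)))))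
                     (shuffles-length (x ∷ u) v)))

shuffles-length-∷ʳ : ∀ u v b → All (λ w → length w ≡ length u + suc (length v)) (shuffles u (v ∷ʳ b))
shuffles-length-∷ʳ u v b =
  All.map (λ eq → trans eq (cong (length u +_) (length-∷ʳ v b))) (shuffles-length u (v ∷ʳ b))

endsWith-∷ʳ : ∀ c w a → endsWith c (w ∷ʳ a) ≡ ⌊ a ≟ℤ c ⌋
endsWith-∷ʳ c []          a = refl
endsWith-∷ʳ c (x ∷ [])    a = refl
endsWith-∷ʳ c (x ∷ y ∷ w) a = endsWith-∷ʳ c (y ∷ w) a

fmajGen-↭ : ∀ q {ws ws′} → ws ↭ ws′ → fmajGen q ws ≡ fmajGen q ws′
fmajGen-↭ q p = sum-↭ (↭.map⁺ (λ α → q ^ fmaj α) p)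

fmajGen-++ : ∀ q ws ws′ → fmajGen q (ws ++ ws′) ≡ fmajGen q ws + fmajGen q ws′
fmajGen-++ q ws ws′ =
  trans (cong sum (map-++ (λ α → q ^ fmaj α) ws ws′)) (sum-++ (map (λ α → q ^ fmaj α) ws) _)

fmajGen-∷ʳ : ∀ q z a ℓ {ws : List SignedWord} → All (λ w → length w ≡ ℓ) ws →
  fmajGen q (map (_∷ʳ a) (map (_∷ʳ z) ws)) ≡ fmajGen q (map (_∷ʳ z) ws) * snocFactor q (suc ℓ) z a
fmajGen-∷ʳ q z a ℓ []                  = refl
fmajGen-∷ʳ q z a ℓ {w ∷ ws} (refl ∷ ℓs) = begin
  q ^ fmaj (w ∷ʳ z ∷ʳ a) + fmajGen q (map (_∷ʳ a) (map (_∷ʳ z) ws))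
    ≡⟨ cong₂ _+_ (^fmaj-∷ʳ q w z a) (fmajGen-∷ʳ q z a ℓ ℓs) ⟩
  q ^ fmaj (w ∷ʳ z) * f + fmajGen q (map (_∷ʳ z) ws) * f
    ≡⟨ *-distribʳ-+ f (q ^ fmaj (w ∷ʳ z)) _ ⟨
  (q ^ fmaj (w ∷ʳ z) + fmajGen q (map (_∷ʳ z) ws)) * f ∎
  where
  open ≡-Reasoning
  f = snocFactor q (suc ℓ) z a

fmajGen-shufflesEndingWith-∷ʳ : ∀ q u z a v b →
  fmajGen q (shufflesEndingWith (u ∷ʳ z) a v b) ≡
    fmajGen q (shufflesEndingWith u z v b) * snocFactor q (suc (length u) + suc (length v)) z a
  + fmajGen q (shufflesEndingWith v b u z) * snocFactor q (suc (length v) + suc (length u)) b a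
fmajGen-shufflesEndingWith-∷ʳ q u z a v b = begin
  fmajGen q (map (_∷ʳ a) (shuffles (u ∷ʳ z) (v ∷ʳ b)))
    ≡⟨ fmajGen-↭ q (↭.map⁺ (_∷ʳ a) (shuffles-∷ʳ u z v b)) ⟩
  fmajGen q (map (_∷ʳ a) (shufflesEndingWith u z v b ++ shufflesEndingWith v b u z))
    ≡⟨ cong (fmajGen q) (map-++ (_∷ʳ a) (shufflesEndingWith u z v b) _) ⟩
  fmajGen q (map (_∷ʳ a) (shufflesEndingWith u z v b) ++ map (_∷ʳ a) (shufflesEndingWith v b u z))
    ≡⟨ fmajGen-++ q (map (_∷ʳ a) (shufflesEndingWith u z v b)) _ ⟩
  fmajGen q (map (_∷ʳ a) (shufflesEndingWith u z v b)) + fmajGen q (map (_∷ʳ a) (shufflesEndingWith v b u z))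
    ≡⟨ cong₂ _+_ (fmajGen-∷ʳ q z a _ (shuffles-length-∷ʳ u v b))
                 (fmajGen-∷ʳ q b a _ (shuffles-length-∷ʳ v u z)) ⟩
  fmajGen q (shufflesEndingWith u z v b) * snocFactor q (suc (length u) + suc (length v)) z a
    + fmajGen q (shufflesEndingWith v b u z) * snocFactor q (suc (length v) + suc (length u)) b a ∎
  where open ≡-Reasoning

fmajGen-shufflesSb : ∀ q σ s π p → p ≢ s →
  fmajGen q (shufflesSb s (σ ∷ʳ s) (π ∷ʳ p)) ≡ fmajGen q (shufflesEndingWith σ s π p)
fmajGen-shufflesSb q σ s π p p≢s = begin
  fmajGen q (filter endsWith-s? (shuffles (σ ∷ʳ s) (π ∷ʳ p)))
    ≡⟨ fmajGen-↭ q (↭.filter-↭ endsWith-s? (shuffles-∷ʳ σ s π p)) ⟩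
  fmajGen q (filter endsWith-s? (shufflesEndingWith σ s π p ++ shufflesEndingWith π p σ s))
    ≡⟨ cong (fmajGen q) (filter-++ endsWith-s? (shufflesEndingWith σ s π p) _) ⟩
  fmajGen q (filter endsWith-s? (shufflesEndingWith σ s π p) ++ filter endsWith-s? (shufflesEndingWith π p σ s))
    ≡⟨ cong₂ (λ xs ys → fmajGen q (xs ++ ys))
             (filter-all endsWith-s? ends-s) (filter-none endsWith-s? ends-p) ⟩
  fmajGen q (shufflesEndingWith σ s π p ++ [])
    ≡⟨ cong (fmajGen q) (++-identityʳ (shufflesEndingWith σ s π p)) ⟩
  fmajGen q (shufflesEndingWith σ s π p) ∎
  where
  open ≡-Reasoning
  endsWith-s? = λ α → T? (endsWith s α)
  ends-s : All (λ α → T (endsWith s α)) (shufflesEndingWith σ s π p)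
  ends-s = All.map⁺ (All.universal (λ w → subst T (sym (endsWith-∷ʳ s w s)) (fromWitness refl)) _)
  ends-p : All (λ α → ¬ T (endsWith s α)) (shufflesEndingWith π p σ s)
  ends-p = All.map⁺ (All.universal (λ w t → p≢s (toWitness (subst T (endsWith-∷ʳ s w p) t))) _)

-- qBinom Q m n is the Gaussian binomial coefficient [m + n choose m] in Q.
qBinom : ℕ → ℕ → ℕ → ℕ
qBinom Q zero    n       = 1
qBinom Q (suc m) zero    = 1
qBinom Q (suc m) (suc n) = qBinom Q m (suc n) + Q ^ suc m * qBinom Q (suc m) n

qInt-+ : ∀ Q m n → qInt Q (m + n) ≡ qInt Q m + Q ^ m * qInt Q n
qInt-+ Q zero    n = sym (+-identityʳ _)
qInt-+ Q (suc m) n rewrite qInt-+ Q m n = distrib Q (qInt Q m) (Q ^ m) (qInt Q n)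
  where
  distrib : ∀ Q x y z → 1 + Q * (x + y * z) ≡ 1 + Q * x + Q * y * z
  distrib = solve-∀

qFact-nonZero : ∀ Q n → NonZero (qFact Q n)
qFact-nonZero Q zero    = _
qFact-nonZero Q (suc n) = m*n≢0 (suc (Q * qInt Q n)) (qFact Q n) {{_}} {{qFact-nonZero Q n}}

qBinom-qFact : ∀ Q m n → qBinom Q m n * qFact Q m * qFact Q n ≡ qFact Q (m + n)
qBinom-qFact Q zero    n       = +-identityʳ _
qBinom-qFact Q (suc m) zero    =
  trans (*-identityʳ _) (trans (+-identityʳ _) (cong (qFact Q) (sym (+-identityʳ (suc m)))))
qBinom-qFact Q (suc m) (suc n) = begin
  (X + Q ^ suc m * Y) * (Iₘ * Fₘ) * (Iₙ * Fₙ)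
    ≡⟨ expand X Y (Q ^ suc m) Iₘ Fₘ Iₙ Fₙ ⟩
  Iₘ * (X * Fₘ * (Iₙ * Fₙ)) + Q ^ suc m * Iₙ * (Y * (Iₘ * Fₘ) * Fₙ)
    ≡⟨ cong₂ (λ s t → Iₘ * s + Q ^ suc m * Iₙ * t)
             (qBinom-qFact Q m (suc n)) (qBinom-qFact Q (suc m) n) ⟩
  Iₘ * qFact Q (m + suc n) + Q ^ suc m * Iₙ * qFact Q (suc m + n)
    ≡⟨ cong (λ k → Iₘ * qFact Q k + Q ^ suc m * Iₙ * qFact Q (suc m + n)) (+-suc m n) ⟩
  Iₘ * qFact Q (suc m + n) + Q ^ suc m * Iₙ * qFact Q (suc m + n)
    ≡⟨ *-distribʳ-+ (qFact Q (suc m + n)) Iₘ (Q ^ suc m * Iₙ) ⟨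
  (Iₘ + Q ^ suc m * Iₙ) * qFact Q (suc m + n)
    ≡⟨ cong (_* qFact Q (suc m + n)) (qInt-+ Q (suc m) (suc n)) ⟨
  qInt Q (suc m + suc n) * qFact Q (suc m + n)
    ≡⟨ cong (λ k → qInt Q (suc m + suc n) * qFact Q k) (+-suc m n) ⟨
  qFact Q (suc m + suc n) ∎
  where
  open ≡-Reasoning
  X = qBinom Q m (suc n)
  Y = qBinom Q (suc m) n
  Iₘ = qInt Q (suc m)
  Iₙ = qInt Q (suc n)
  Fₘ = qFact Q m
  Fₙ = qFact Q n
  expand : ∀ X Y P Iₘ Fₘ Iₙ Fₙ →
    (X + P * Y) * (Iₘ * Fₘ) * (Iₙ * Fₙ)
      ≡ Iₘ * (X * Fₘ * (Iₙ * Fₙ)) + P * Iₙ * (Y * (Iₘ * Fₘ) * Fₙ)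
  expand = solve-∀

qBinom-comm : ∀ Q m n → qBinom Q m n ≡ qBinom Q n m
qBinom-comm Q m n = *-cancelʳ-≡ (qBinom Q m n) (qBinom Q n m) (qFact Q m * qFact Q n)
  {{m*n≢0 _ _ {{qFact-nonZero Q m}} {{qFact-nonZero Q n}}}}
  (begin
    qBinom Q m n * (qFact Q m * qFact Q n) ≡⟨ *-assoc (qBinom Q m n) _ _ ⟨
    qBinom Q m n * qFact Q m * qFact Q n   ≡⟨ qBinom-qFact Q m n ⟩
    qFact Q (m + n)                        ≡⟨ cong (qFact Q) (+-comm m n) ⟩
    qFact Q (n + m)                        ≡⟨ qBinom-qFact Q n m ⟨
    qBinom Q n m * qFact Q n * qFact Q m   ≡⟨ *-assoc (qBinom Q n m) _ _ ⟩
    qBinom Q n m * (qFact Q n * qFact Q m) ≡⟨ cong (qBinom Q n m *_) (*-comm (qFact Q n) (qFact Q m)) ⟩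
    qBinom Q n m * (qFact Q m * qFact Q n) ∎)
  where open ≡-Reasoning

qBinom-pascal : ∀ Q t m n → qBinom Q (suc m) (suc n) ≡
  Q ^ (𝟙 t * suc n) * qBinom Q m (suc n) + Q ^ (𝟙 (not t) * suc m) * qBinom Q (suc m) n
qBinom-pascal Q false m n =
  cong₂ _+_ (sym (+-identityʳ _)) (cong (λ k → Q ^ k * qBinom Q (suc m) n) (sym (+-identityʳ (suc m))))
qBinom-pascal Q true  m n = begin
  qBinom Q (suc m) (suc n)                                  ≡⟨ qBinom-comm Q (suc m) (suc n) ⟩
  qBinom Q n (suc m) + Q ^ suc n * qBinom Q (suc n) m
    ≡⟨ cong₂ (λ s t → s + Q ^ suc n * t) (qBinom-comm Q n (suc m)) (qBinom-comm Q (suc n) m) ⟩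
  qBinom Q (suc m) n + Q ^ suc n * qBinom Q m (suc n)
    ≡⟨ swap (qBinom Q (suc m) n) (Q ^ suc n) (qBinom Q m (suc n)) ⟩
  Q ^ suc n * qBinom Q m (suc n) + 1 * qBinom Q (suc m) n
    ≡⟨ cong (λ k → Q ^ k * qBinom Q m (suc n) + 1 * qBinom Q (suc m) n) (+-identityʳ (suc n)) ⟨
  Q ^ (1 * suc n) * qBinom Q m (suc n) + 1 * qBinom Q (suc m) n ∎
  where
  open ≡-Reasoning
  swap : ∀ x p y → x + p * y ≡ p * y + 1 * x
  swap = solve-∀

^-double : ∀ q k → (q * q) ^ k ≡ q ^ (2 * k)
^-double q k = trans (cong (λ r → (q * r) ^ k) (sym (*-identityʳ q))) (^-*-assoc q 2 k)

qBinom-pascal-q² : ∀ q t i j →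
  q ^ (2 * (𝟙 (not t) * suc j)) * qBinom (q * q) (suc j) i + q ^ (2 * (𝟙 t * suc i)) * qBinom (q * q) (suc i) j
    ≡ qBinom (q * q) (suc j) (suc i)
qBinom-pascal-q² q t i j = begin
  q ^ (2 * (𝟙 (not t) * n)) * qBinom Q n i + q ^ (2 * (𝟙 t * m)) * qBinom Q m j
    ≡⟨ cong₂ (λ r s → r * qBinom Q n i + s * qBinom Q m j)
             (^-double q (𝟙 (not t) * n)) (^-double q (𝟙 t * m)) ⟨
  Q ^ (𝟙 (not t) * n) * qBinom Q n i + Q ^ (𝟙 t * m) * qBinom Q m j
    ≡⟨ +-comm (Q ^ (𝟙 (not t) * n) * qBinom Q n i) _ ⟩
  Q ^ (𝟙 t * m) * qBinom Q m j + Q ^ (𝟙 (not t) * n) * qBinom Q n i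
    ≡⟨ cong (λ r → Q ^ (𝟙 t * m) * r + Q ^ (𝟙 (not t) * n) * qBinom Q n i) (qBinom-comm Q m j) ⟩
  Q ^ (𝟙 t * m) * qBinom Q j m + Q ^ (𝟙 (not t) * n) * qBinom Q n i
    ≡⟨ qBinom-pascal Q t j i ⟨
  qBinom Q n m ∎
  where
  open ≡-Reasoning
  Q = q * q
  m = suc i
  n = suc j

^-combine : ∀ q {e₁ k₁ e₂ k₂ e d₁ d₂} C₁ C₂ → e₁ + k₁ ≡ e + d₁ → e₂ + k₂ ≡ e + d₂ →
  q ^ e₁ * C₁ * q ^ k₁ + q ^ e₂ * C₂ * q ^ k₂ ≡ q ^ e * (q ^ d₁ * C₁ + q ^ d₂ * C₂)
^-combine q {e₁} {k₁} {e₂} {k₂} {e} {d₁} {d₂} C₁ C₂ p₁ p₂ = begin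
  q ^ e₁ * C₁ * q ^ k₁ + q ^ e₂ * C₂ * q ^ k₂
    ≡⟨ cong₂ _+_ (collect e₁ k₁ C₁) (collect e₂ k₂ C₂) ⟩
  q ^ (e₁ + k₁) * C₁ + q ^ (e₂ + k₂) * C₂
    ≡⟨ cong₂ (λ s t → q ^ s * C₁ + q ^ t * C₂) p₁ p₂ ⟩
  q ^ (e + d₁) * C₁ + q ^ (e + d₂) * C₂
    ≡⟨ cong₂ (λ s t → s * C₁ + t * C₂) (^-distribˡ-+-* q e d₁) (^-distribˡ-+-* q e d₂) ⟩
  q ^ e * q ^ d₁ * C₁ + q ^ e * q ^ d₂ * C₂
    ≡⟨ factor (q ^ e) (q ^ d₁) C₁ (q ^ d₂) C₂ ⟩
  q ^ e * (q ^ d₁ * C₁ + q ^ d₂ * C₂) ∎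
  where
  open ≡-Reasoning
  collect : ∀ e k C → q ^ e * C * q ^ k ≡ q ^ (e + k) * C
  collect e k C = trans (*-comm-middle (q ^ e) C (q ^ k)) (cong (_* C) (sym (^-distribˡ-+-* q e k)))
    where
    *-comm-middle : ∀ x y z → x * y * z ≡ x * z * y
    *-comm-middle = solve-∀
  factor : ∀ p x C y D → p * x * C + p * y * D ≡ p * (x * C + y * D)
  factor = solve-∀

exponent-shift : ∀ {x y w t} A B c k l → x + y ≡ w + t →
  A + B + 2 * (x * l) + (2 * (y * (k + l)) + c) ≡ A + 2 * (y * k) + c + B + 2 * (w * l) + 2 * (t * l)
exponent-shift {x} {y} {w} {t} A B c k l x+y≡w+t = begin
  A + B + 2 * (x * l) + (2 * (y * (k + l)) + c) ≡⟨ regroup A B c x y k l ⟩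
  A + 2 * (y * k) + c + B + 2 * ((x + y) * l)
    ≡⟨ cong (λ s → A + 2 * (y * k) + c + B + 2 * (s * l)) x+y≡w+t ⟩
  A + 2 * (y * k) + c + B + 2 * ((w + t) * l)   ≡⟨ distrib (A + 2 * (y * k) + c + B) w t l ⟩
  A + 2 * (y * k) + c + B + 2 * (w * l) + 2 * (t * l) ∎
  where
  open ≡-Reasoning
  regroup : ∀ A B c x y k l →
    A + B + 2 * (x * l) + (2 * (y * (k + l)) + c) ≡ A + 2 * (y * k) + c + B + 2 * ((x + y) * l)
  regroup = solve-∀
  distrib : ∀ E w t l → E + 2 * ((w + t) * l) ≡ E + 2 * (w * l) + 2 * (t * l)
  distrib = solve-∀

fmajClosed : ℕ → SignedWord → ℤ → SignedWord → ℤ → ℕ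
fmajClosed q u a v b =
  q ^ (fmaj (u ∷ʳ a) + fmaj (v ∷ʳ b) + 2 * (𝟙 (a ≺ᵇ b) * suc (length v)))
    * qBinom (q * q) (suc (length v)) (length u)

fmajClosed-∷ʳ : ∀ q u z a v b → z ≢ b →
  fmajClosed q (u ∷ʳ z) a v b ≡
    fmajClosed q u z v b * snocFactor q (suc (length u) + suc (length v)) z a
  + fmajClosed q v b u z * snocFactor q (suc (length v) + suc (length u)) b a
fmajClosed-∷ʳ q u z a v b z≢b with descent-cocycle a z b z≢b
... | t , X+Y≡W+t′ , X′+W≡Y+t = sym (begin
  q ^ (Fz + Fb + 2 * (X * n)) * qBinom Q n i * snocFactor q (m + n) z a
    + q ^ (Fb + Fz + 2 * (X′ * m)) * qBinom Q m j * snocFactor q (n + m) b a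
    ≡⟨ ^-combine q {Fz + Fb + 2 * (X * n)} {2 * (𝟙 (a ≺ᵇ z) * (m + n)) + 𝟙 (isNeg a)}
                   {Fb + Fz + 2 * (X′ * m)} {2 * (W * (n + m)) + 𝟙 (isNeg a)}
                   {e} {2 * (𝟙 (not t) * n)} {2 * (𝟙 t * m)} (qBinom Q n i) (qBinom Q m j) ex₁ ex₂ ⟩
  q ^ e * (q ^ (2 * (𝟙 (not t) * n)) * qBinom Q n i + q ^ (2 * (𝟙 t * m)) * qBinom Q m j)
    ≡⟨ cong (q ^ e *_) (qBinom-pascal-q² q t i j) ⟩
  q ^ e * qBinom Q n m
    ≡⟨ cong (λ k → q ^ e * qBinom Q n k) (length-∷ʳ u z) ⟨
  fmajClosed q (u ∷ʳ z) a v b ∎)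
  where
  open ≡-Reasoning
  Q = q * q
  i = length u
  j = length v
  m = suc i
  n = suc j
  Fz = fmaj (u ∷ʳ z)
  Fb = fmaj (v ∷ʳ b)
  X = 𝟙 (z ≺ᵇ b)
  X′ = 𝟙 (b ≺ᵇ z)
  W = 𝟙 (a ≺ᵇ b)
  e = fmaj (u ∷ʳ z ∷ʳ a) + Fb + 2 * (W * n)
  fmaj-uza : Fz + 2 * (𝟙 (a ≺ᵇ z) * m) + 𝟙 (isNeg a) ≡ fmaj (u ∷ʳ z ∷ʳ a)
  fmaj-uza = sym (fmaj-∷ʳ u z a)
  ex₁ : Fz + Fb + 2 * (X * n) + (2 * (𝟙 (a ≺ᵇ z) * (m + n)) + 𝟙 (isNeg a)) ≡ e + 2 * (𝟙 (not t) * n)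
  ex₁ = trans (exponent-shift {X} {𝟙 (a ≺ᵇ z)} {W} {𝟙 (not t)} Fz Fb (𝟙 (isNeg a)) m n X+Y≡W+t′)
              (cong (λ f → f + Fb + 2 * (W * n) + 2 * (𝟙 (not t) * n)) fmaj-uza)
  ex₂ : Fb + Fz + 2 * (X′ * m) + (2 * (W * (n + m)) + 𝟙 (isNeg a)) ≡ e + 2 * (𝟙 t * m)
  ex₂ = trans (exponent-shift {X′} {W} {𝟙 (a ≺ᵇ z)} {𝟙 t} Fb Fz (𝟙 (isNeg a)) n m X′+W≡Y+t)
       (trans (swap Fb (2 * (W * n)) (𝟙 (isNeg a)) Fz (2 * (𝟙 (a ≺ᵇ z) * m)) (2 * (𝟙 t * m)))
              (cong (λ f → f + Fb + 2 * (W * n) + 2 * (𝟙 t * m)) fmaj-uza))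
    where
    swap : ∀ B y c A x t → B + y + c + A + x + t ≡ A + x + c + B + y + t
    swap = solve-∀

fmajGen-shufflesEndingWith : ∀ q {u} → Reverse u → ∀ {v} → Reverse v → ∀ a b →
  Disjoint (u ∷ʳ a) (v ∷ʳ b) → fmajGen q (shufflesEndingWith u a v b) ≡ fmajClosed q u a v b
fmajGen-shufflesEndingWith q [] {v} _ a b _ =
  trans (+-identityʳ _) (trans (cong (q ^_) exponent) (sym (*-identityʳ _)))
  where
  exponent : fmaj (v ∷ʳ b ∷ʳ a) ≡ fmaj [ a ] + fmaj (v ∷ʳ b) + 2 * (𝟙 (a ≺ᵇ b) * suc (length v))
  exponent = trans (fmaj-∷ʳ v b a)
                   (regroup (fmaj (v ∷ʳ b)) (2 * (𝟙 (a ≺ᵇ b) * suc (length v))) (𝟙 (isNeg a)))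
    where
    regroup : ∀ F k n → F + k + n ≡ n + 0 + F + k
    regroup = solve-∀
fmajGen-shufflesEndingWith q (u ∶ ru ∶ʳ z) {v} rv a b disjoint = begin
  fmajGen q (shufflesEndingWith (u ∷ʳ z) a v b)
    ≡⟨ fmajGen-shufflesEndingWith-∷ʳ q u z a v b ⟩
  fmajGen q (shufflesEndingWith u z v b) * f₁ + fmajGen q (shufflesEndingWith v b u z) * f₂
    ≡⟨ cong₂ (λ s t → s * f₁ + t * f₂) (fmajGen-shufflesEndingWith q ru rv z b disjoint′)
                                        (fmajGen-shufflesEndingWith q rv ru b z (Disjoint.sym disjoint′)) ⟩
  fmajClosed q u z v b * f₁ + fmajClosed q v b u z * f₂
    ≡⟨ fmajClosed-∷ʳ q u z a v b z≢b ⟨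
  fmajClosed q (u ∷ʳ z) a v b ∎
  where
  open ≡-Reasoning
  f₁ = snocFactor q (suc (length u) + suc (length v)) z a
  f₂ = snocFactor q (suc (length v) + suc (length u)) b a
  disjoint′ : Disjoint (u ∷ʳ z) (v ∷ʳ b)
  disjoint′ (p , q) = disjoint (∈-++⁺ˡ p , q)
  z≢b : z ≢ b
  z≢b refl = disjoint (∈-++⁺ˡ (∈-++⁺ʳ u (here refl)) , ∈-++⁺ʳ v (here refl))

lemma5p7 : (σ' π' : List ℤ) (s p : ℤ) →
    IsSignedPerm (σ' ++ [ s ]) → IsSignedPerm (π' ++ [ p ]) →
    DisjointSupp (σ' ++ [ s ]) (π' ++ [ p ]) → s ≺ p →
    (q : ℕ) →
    fmajGen q (shufflesSb s (σ' ++ [ s ]) (π' ++ [ p ]))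
        * qFact (q * q) (length π' + 1) * qFact (q * q) (length σ')
      ≡ q ^ (fmaj (σ' ++ [ s ]) + fmaj (π' ++ [ p ]) + 2 * (length π' + 1))
        * qFact (q * q) (length π' + 1 + length σ')
lemma5p7 σ' π' s p _ _ supp-disjoint s≺p q rewrite +-comm (length π') 1 = begin
  fmajGen q (shufflesSb s (σ' ∷ʳ s) (π' ∷ʳ p)) * qFact Q n * qFact Q i
    ≡⟨ cong (λ g → g * qFact Q n * qFact Q i) sum-closed ⟩
  q ^ (F + 2 * (𝟙 (s ≺ᵇ p) * n)) * qBinom Q n i * qFact Q n * qFact Q i
    ≡⟨ cong (λ w → q ^ (F + 2 * (𝟙 w * n)) * qBinom Q n i * qFact Q n * qFact Q i) s≺p ⟩
  q ^ (F + 2 * (1 * n)) * qBinom Q n i * qFact Q n * qFact Q i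
    ≡⟨ cong (λ k → q ^ (F + 2 * k) * qBinom Q n i * qFact Q n * qFact Q i) (*-identityˡ n) ⟩
  q ^ (F + 2 * n) * qBinom Q n i * qFact Q n * qFact Q i
    ≡⟨ assoc (q ^ (F + 2 * n)) (qBinom Q n i) (qFact Q n) (qFact Q i) ⟩
  q ^ (F + 2 * n) * (qBinom Q n i * qFact Q n * qFact Q i)
    ≡⟨ cong (q ^ (F + 2 * n) *_) (qBinom-qFact Q n i) ⟩
  q ^ (F + 2 * n) * qFact Q (n + i) ∎
  where
  open ≡-Reasoning
  Q = q * q
  i = length σ'
  n = suc (length π')
  F = fmaj (σ' ∷ʳ s) + fmaj (π' ∷ʳ p)
  disjoint : Disjoint (σ' ∷ʳ s) (π' ∷ʳ p)
  disjoint (x∈σ , x∈π) = supp-disjoint (∈-map⁺ ∣_∣ x∈σ) (∈-map⁺ ∣_∣ x∈π)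
  sum-closed : fmajGen q (shufflesSb s (σ' ∷ʳ s) (π' ∷ʳ p)) ≡ fmajClosed q σ' s π' p
  sum-closed = trans (fmajGen-shufflesSb q σ' s π' p (λ { refl → ≺-irrefl s s≺p }))
                     (fmajGen-shufflesEndingWith q (reverseView σ') (reverseView π') s p disjoint)
  assoc : ∀ a b c d → a * b * c * d ≡ a * (b * c * d)
  assoc = solve-∀
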